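{- Let $k$ be a positive integer and $S=\langle 4k+5,4k+7,4k+11,4k+13\rangle$. Then \[\mathrm{Ap}(S,4k+5)=\{0,\,4k+7,\,4k+11,\,4k+13,\,2(4k+7)\}\cup\{\,j(4k+13)-6,\ j(4k+13)-4,\ j(4k+13)-2,\ j(4k+13)\mid 2\le j\le k+1\,\}.\]
   Context: $\mathbb{N}=\{0,1,2,\dots\}$. For $X\subseteq\mathbb{N}$, $\langle X\rangle$ is the submonoid of $(\mathbb{N},+)$ generated by $X$; here it is a numerical semigroup. For a numerical semigroup $S$ and $n\in S\setminus\{0\}$, the Apéry set is $\mathrm{Ap}(S,n)=\{s\in S\mid s-n\notin S\}$. -}

module Defs where

open import Data.Nat using (ℕ; zero; suc; _+_; _*_; _∸_; _≤_)
open import Data.List using (List; []; _∷_)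
open import Data.List.Membership.Propositional using (_∈_)
open import Data.Product using (_×_; Σ; ∃)
open import Relation.Nullary using (¬_)
open import Relation.Binary.PropositionalEquality using (_≡_)

data ⟨_⟩ (X : List ℕ) : ℕ → Set where
  zero-mem : ⟨ X ⟩ 0
  add-gen  : ∀ {g s} → g ∈ X → ⟨ X ⟩ s → ⟨ X ⟩ (g + s)

-- Integer difference s - n lies in S (negative integers are never in S ⊆ ℕ).
DiffIn : (ℕ → Set) → ℕ → ℕ → Set
DiffIn S s n = Σ ℕ λ m → (m + n ≡ s) × S m

Ap : (ℕ → Set) → ℕ → ℕ → Set
Ap S n s = S s × ¬ DiffIn S s n

{-# OPTIONS --safe #-}
-- Put n = 4k+5. The generators are n + 2i for i ∈ {0,1,3,4}, so the elements of S are the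
-- m n + 2 t with t an m-fold sum of {0,1,3,4}, i.e. 0 ≤ t ≤ 4m and (m,t) ≠ (1,2). As n is odd,
-- comparing two such representations mod 2 shows that one with t < n has the largest m.
-- Hence x − n ∉ S exactly when x = m n + 2 t with t ∈ {4m−3,…,4m} and t < n (which forces
-- m ≤ k+1), or x = 2n + 4, because x − n = n + 4 is the gap (1,2). Finally
-- m n + 2 t = m (n + 8) − 2 (4m − t) turns row m into the paper's j (4k+13) − 2r.
module Submission where

open import Defs
open import Data.Nat using (ℕ; zero; suc; _+_; _*_; _∸_; _≤_; _<_; z≤n; s≤s; _≟_)
open import Data.Nat.Properties
open import Data.Nat.DivMod using (_%_; m*n%n≡0; [m+kn]%n≡m%n; %-congˡ)
open import Data.Nat.Tactic.RingSolver using (solve-∀)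
open import Data.List using (List; []; _∷_; map)
open import Data.List.Membership.Propositional using (_∈_)
open import Data.List.Membership.Propositional.Properties using (∈-map⁺; ∈-map⁻)
open import Data.List.Relation.Unary.Any using (here; there)
open import Data.Product using (_×_; Σ; ∃; ∃₂; _,_; proj₂)
open import Data.Sum using (_⊎_; inj₁; inj₂)
open import Relation.Nullary using (¬_; yes; no; _×-dec_; contradiction)
open import Relation.Binary.PropositionalEquality
open import Function.Base using (_∘_)
open import Function.Bundles using (_⇔_; mk⇔; module Equivalence)
open import Function.Properties.Equivalence using () renaming (trans to ⇔-trans)

data Sums (D : List ℕ) : ℕ → ℕ → Set where
  []  : Sums D 0 0
  _∷_ : ∀ {i m t} → i ∈ D → Sums D m t → Sums D (suc m) (i + t)

add-shifted-gen : ∀ n d i m t → n + d * i + (m * n + d * t) ≡ suc m * n + d * (i + t)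
add-shifted-gen = solve-∀

module _ (n d : ℕ) {D : List ℕ} where

  ∈⟨map⟩⇒Sums : ∀ {x} → ⟨ map (λ i → n + d * i) D ⟩ x →
                ∃₂ λ m t → x ≡ m * n + d * t × Sums D m t
  ∈⟨map⟩⇒Sums zero-mem = 0 , 0 , sym (*-zeroʳ d) , []
  ∈⟨map⟩⇒Sums (add-gen g∈ s) with ∈-map⁻ (λ i → n + d * i) g∈ | ∈⟨map⟩⇒Sums s
  ... | i , i∈D , refl | m , t , refl , sums =
    suc m , i + t , add-shifted-gen n d i m t , i∈D ∷ sums

  Sums⇒∈⟨map⟩ : ∀ {m t} → Sums D m t → ⟨ map (λ i → n + d * i) D ⟩ (m * n + d * t)
  Sums⇒∈⟨map⟩ []              = subst ⟨ map (λ i → n + d * i) D ⟩ (sym (*-zeroʳ d)) zero-mem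
  Sums⇒∈⟨map⟩ (_∷_ {i} {m} {t} i∈D sums) =
    subst ⟨ map (λ i → n + d * i) D ⟩ (add-shifted-gen n d i m t)
      (add-gen (∈-map⁺ (λ i → n + d * i) i∈D) (Sums⇒∈⟨map⟩ sums))

  ∈⟨map⟩⇔Sums : ∀ x → ⟨ map (λ i → n + d * i) D ⟩ x ⇔
                      ∃₂ λ m t → x ≡ m * n + d * t × Sums D m t
  ∈⟨map⟩⇔Sums x = mk⇔ ∈⟨map⟩⇒Sums λ { (m , t , refl , sums) → Sums⇒∈⟨map⟩ sums }

Steps : List ℕ
Steps = 0 ∷ 1 ∷ 3 ∷ 4 ∷ []

-- The m-fold sums of {0,1,3,4} are exactly 0,…,4m, except 2 when m = 1.
Admissible : ℕ → ℕ → Set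
Admissible m t = t ≤ 4 * m × ¬ (m ≡ 1 × t ≡ 2)

Steps⊆[0,4]∖2 : ∀ {i} → i ∈ Steps → i ≤ 4 × i ≢ 2
Steps⊆[0,4]∖2 (here refl)                         = z≤n , λ ()
Steps⊆[0,4]∖2 (there (here refl))                 = s≤s z≤n , λ ()
Steps⊆[0,4]∖2 (there (there (here refl)))         = s≤s (s≤s (s≤s z≤n)) , λ ()
Steps⊆[0,4]∖2 (there (there (there (here refl)))) = ≤-refl , λ ()

Sums-Steps⇒Admissible : ∀ {m t} → Sums Steps m t → Admissible m t
Sums-Steps⇒Admissible []                = z≤n , λ ()
Sums-Steps⇒Admissible (_∷_ {i} {m} {t} i∈ sums)
  with Steps⊆[0,4]∖2 i∈ | Sums-Steps⇒Admissible sums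
... | i≤4 , i≢2 | t≤4m , _ =
  subst (i + t ≤_) (sym (*-suc 4 m)) (+-mono-≤ i≤4 t≤4m) , not-1,2
  where
    not-1,2 : ¬ (suc m ≡ 1 × i + t ≡ 2)
    not-1,2 (refl , i+t≡2) = i≢2 (begin
      i      ≡⟨ sym (+-identityʳ i) ⟩
      i + 0  ≡⟨ cong (i +_) (sym (n≤0⇒n≡0 t≤4m)) ⟩
      i + t  ≡⟨ i+t≡2 ⟩
      2      ∎)
      where open ≡-Reasoning

Admissible⇒Sums-Steps : ∀ m t → Admissible m t → Sums Steps m t
Admissible⇒Sums-Steps zero t (t≤0 , _) rewrite n≤0⇒n≡0 t≤0 = []
Admissible⇒Sums-Steps (suc m) 0 _ =
  here refl ∷ Admissible⇒Sums-Steps m 0 (z≤n , λ ())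
Admissible⇒Sums-Steps (suc m) 1 _ =
  there (here refl) ∷ Admissible⇒Sums-Steps m 0 (z≤n , λ ())
Admissible⇒Sums-Steps (suc zero) 2 (_ , not-1,2) = contradiction (refl , refl) not-1,2
Admissible⇒Sums-Steps (suc (suc m)) 2 _ =
  there (here refl) ∷ Admissible⇒Sums-Steps (suc m) 1 (s≤s z≤n , λ ())
Admissible⇒Sums-Steps (suc m) 3 _ =
  there (there (here refl)) ∷ Admissible⇒Sums-Steps m 0 (z≤n , λ ())
Admissible⇒Sums-Steps (suc m) (suc (suc (suc (suc u)))) (t≤4m , _) with m ≟ 1 ×-dec u ≟ 2
... | yes (refl , refl) =
  there (there (here refl)) ∷ Admissible⇒Sums-Steps 1 3 (s≤s (s≤s (s≤s z≤n)) , λ ())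
... | no not-1,2 = there (there (there (here refl))) ∷ Admissible⇒Sums-Steps m u (u≤4m , not-1,2)
  where
    u≤4m : u ≤ 4 * m
    u≤4m = +-cancelˡ-≤ 4 u (4 * m) (subst (4 + u ≤_) (*-suc 4 m) t≤4m)

Gens : ℕ → List ℕ
Gens n = map (λ i → n + 2 * i) Steps

∈⟨Gens⟩⇔Admissible : ∀ n x → ⟨ Gens n ⟩ x ⇔ ∃₂ λ m t → x ≡ m * n + 2 * t × Admissible m t
∈⟨Gens⟩⇔Admissible n x = ⇔-trans (∈⟨map⟩⇔Sums n 2 x) (mk⇔
  (λ { (m , t , eq , sums) → m , t , eq , Sums-Steps⇒Admissible sums })
  (λ { (m , t , eq , adm) → m , t , eq , Admissible⇒Sums-Steps m t adm }))

Lowerable : ℕ → ℕ → Set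
Lowerable n x = ∃₂ λ m t → x ≡ suc m * n + 2 * t × Admissible m t

diff-shift : ∀ n m t → m * n + 2 * t + n ≡ suc m * n + 2 * t
diff-shift = solve-∀

DiffIn⟨Gens⟩⇔Lowerable : ∀ n x → DiffIn ⟨ Gens n ⟩ x n ⇔ Lowerable n x
DiffIn⟨Gens⟩⇔Lowerable n x = mk⇔ to from
  where
    to : DiffIn ⟨ Gens n ⟩ x n → Lowerable n x
    to (y , y+n≡x , y∈) with Equivalence.to (∈⟨Gens⟩⇔Admissible n y) y∈
    ... | m , t , refl , adm = m , t , trans (sym y+n≡x) (diff-shift n m t) , adm

    from : Lowerable n x → DiffIn ⟨ Gens n ⟩ x n
    from (m , t , refl , adm) =
      m * n + 2 * t , diff-shift n m t ,
      Equivalence.from (∈⟨Gens⟩⇔Admissible n _) (m , t , refl , adm)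

2*t≢n+2*t′ : ∀ {n} t t′ → n % 2 ≡ 1 → 2 * t ≢ n + 2 * t′
2*t≢n+2*t′ {n} t t′ n-odd eq = 0≢1+n (begin
  0                   ≡⟨ sym (m*n%n≡0 t 2) ⟩
  t * 2 % 2           ≡⟨ %-congˡ (trans (*-comm t 2) (trans eq (cong (n +_) (*-comm 2 t′)))) ⟩
  (n + t′ * 2) % 2    ≡⟨ [m+kn]%n≡m%n n t′ 2 ⟩
  n % 2               ≡⟨ n-odd ⟩
  1                   ∎)
  where open ≡-Reasoning

2*t≢[1+d]*n+2*t′ : ∀ {n t} d t′ → n % 2 ≡ 1 → t < n → 2 * t ≢ suc d * n + 2 * t′
2*t≢[1+d]*n+2*t′ {n} {t} zero t′ n-odd _ eq =
  2*t≢n+2*t′ {n} t t′ n-odd (trans eq (cong (_+ 2 * t′) (+-identityʳ n)))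
2*t≢[1+d]*n+2*t′ {n} {t} (suc e) t′ _ t<n eq = <-irrefl eq (begin-strict
  2 * t                       <⟨ *-monoʳ-< 2 t<n ⟩
  2 * n                       ≤⟨ *-monoˡ-≤ n (m≤m+n 2 e) ⟩
  suc (suc e) * n             ≤⟨ m≤m+n (suc (suc e) * n) (2 * t′) ⟩
  suc (suc e) * n + 2 * t′    ∎)
  where open ≤-Reasoning

split-left : ∀ m d n t → (m + d) * n + 2 * t ≡ m * n + (d * n + 2 * t)
split-left = solve-∀

split-right : ∀ m d n t → (suc m + d) * n + 2 * t ≡ m * n + (suc d * n + 2 * t)
split-right = solve-∀

-- Parity forces m′ ≡ m (mod 2), and m′ ≥ m + 2 would need 2 t ≥ 2 n.
rep-≤ : ∀ {n} m t m′ t′ → n % 2 ≡ 1 → t < n →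
        m * n + 2 * t ≡ m′ * n + 2 * t′ → m′ ≤ m × t ≤ t′
rep-≤ {n} m t m′ t′ n-odd t<n eq with ≤-<-connex m′ m
... | inj₁ m′≤m with d , refl ← m≤n⇒∃[o]m+o≡n m′≤m =
  m′≤m , *-cancelˡ-≤ 2 (≤-trans (m≤n+m (2 * t) (d * n)) (≤-reflexive dn+2t≡2t′))
  where
    dn+2t≡2t′ : d * n + 2 * t ≡ 2 * t′
    dn+2t≡2t′ = +-cancelˡ-≡ (m′ * n) _ _ (trans (sym (split-left m′ d n t)) eq)
... | inj₂ m<m′ with d , refl ← m≤n⇒∃[o]m+o≡n m<m′ =
  contradiction (+-cancelˡ-≡ (m * n) _ _ (trans eq (split-right m d n t′)))
                (2*t≢[1+d]*n+2*t′ d t′ n-odd t<n)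

4*[1+m]≡1+4*m+3 : ∀ m → 4 * suc m ≡ suc (4 * m) + 3
4*[1+m]≡1+4*m+3 = solve-∀

-- t is one of the four largest entries 4m-3,…,4m of row m (for m = 0 this is just x = 0).
RowTop : ℕ → ℕ → Set
RowTop n x = ∃₂ λ m t → x ≡ m * n + 2 * t × Admissible m t × 4 * m ≤ t + 3 × t < n

row-top-not-lowerable : ∀ {n} m t m′ t′ → n % 2 ≡ 1 → t < n → 4 * m ≤ t + 3 → t′ ≤ 4 * m′ →
                        m * n + 2 * t ≢ suc m′ * n + 2 * t′
row-top-not-lowerable m t m′ t′ n-odd t<n 4m≤t+3 t′≤4m′ eq
  with 1+m′≤m , t≤t′ ← rep-≤ m t (suc m′) t′ n-odd t<n eq = <-irrefl refl (begin-strict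
    4 * m         ≤⟨ 4m≤t+3 ⟩
    t + 3         ≤⟨ +-monoˡ-≤ 3 (≤-trans t≤t′ t′≤4m′) ⟩
    4 * m′ + 3    <⟨ ≤-reflexive (sym (4*[1+m]≡1+4*m+3 m′)) ⟩
    4 * suc m′    ≤⟨ *-monoʳ-≤ 4 1+m′≤m ⟩
    4 * m         ∎)
  where open ≤-Reasoning

2n+4-not-lowerable : ∀ {n m′ t′} → n % 2 ≡ 1 → 3 ≤ n → Admissible m′ t′ →
                     2 * n + 4 ≢ suc m′ * n + 2 * t′
2n+4-not-lowerable {n} {m′} {t′} n-odd 3≤n _ eq with rep-≤ 2 2 (suc m′) t′ n-odd 3≤n eq
2n+4-not-lowerable _ _ (z≤n , _) _ | s≤s z≤n , ()
2n+4-not-lowerable {n} {t′ = t′} _ _ (_ , not-1,2) eq | s≤s (s≤s z≤n) , _ =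
  not-1,2 (refl , sym (*-cancelˡ-≡ 2 t′ 2 (+-cancelˡ-≡ (2 * n) (2 * 2) (2 * t′) eq)))

absorb-2n : ∀ m n u → suc m * n + 2 * (n + u) ≡ suc (suc (suc m)) * n + 2 * u
absorb-2n = solve-∀

¬Lowerable⇒2n+4⊎RowTop : ∀ {n} m t → 0 < n → Admissible m t → ¬ Lowerable n (m * n + 2 * t) →
                         m * n + 2 * t ≡ 2 * n + 4 ⊎ RowTop n (m * n + 2 * t)
¬Lowerable⇒2n+4⊎RowTop zero _ 0<n (z≤n , _) _ = inj₂ (0 , 0 , refl , (z≤n , λ ()) , z≤n , 0<n)
¬Lowerable⇒2n+4⊎RowTop {n} (suc m) t _ adm@(t≤4[1+m] , _) not-lowerable
  with ≤-<-connex t (4 * m)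
... | inj₁ t≤4m with m ≟ 1 ×-dec t ≟ 2
...   | yes (refl , refl) = inj₁ refl
...   | no not-1,2        = contradiction (m , t , refl , t≤4m , not-1,2) not-lowerable
¬Lowerable⇒2n+4⊎RowTop {n} (suc m) t _ adm@(t≤4[1+m] , _) not-lowerable | inj₂ 4m<t
  with <-≤-connex t n
... | inj₁ t<n =
  inj₂ (suc m , t , refl , adm , subst (_≤ t + 3) (sym (4*[1+m]≡1+4*m+3 m)) (+-monoˡ-≤ 3 4m<t) , t<n)
... | inj₂ n≤t with u , refl ← m≤n⇒∃[o]m+o≡n n≤t =
  contradiction (suc (suc m) , u , absorb-2n m n u , u≤4[3+m] , λ ()) not-lowerable
  where
    u≤4[3+m] : u ≤ 4 * suc (suc m)
    u≤4[3+m] = ≤-trans (m≤n+m u n) (≤-trans t≤4[1+m] (*-monoʳ-≤ 4 (n≤1+n (suc m))))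

Ap⟨Gens⟩⇔ : ∀ {n} → n % 2 ≡ 1 → 3 ≤ n → ∀ x → Ap ⟨ Gens n ⟩ n x ⇔ (x ≡ 2 * n + 4 ⊎ RowTop n x)
Ap⟨Gens⟩⇔ {n} n-odd 3≤n x = mk⇔ to from
  where
    in-S : ∀ {m t} → Admissible m t → ⟨ Gens n ⟩ (m * n + 2 * t)
    in-S adm = Equivalence.from (∈⟨Gens⟩⇔Admissible n _) (_ , _ , refl , adm)

    to : Ap ⟨ Gens n ⟩ n x → x ≡ 2 * n + 4 ⊎ RowTop n x
    to (x∈ , x-n∉) with Equivalence.to (∈⟨Gens⟩⇔Admissible n x) x∈
    ... | m , t , refl , adm =
      ¬Lowerable⇒2n+4⊎RowTop m t (≤-trans (s≤s z≤n) 3≤n) adm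
        (x-n∉ ∘ Equivalence.from (DiffIn⟨Gens⟩⇔Lowerable n x))

    from : x ≡ 2 * n + 4 ⊎ RowTop n x → Ap ⟨ Gens n ⟩ n x
    from (inj₁ refl) = in-S {2} {2} (s≤s (s≤s z≤n) , λ { (() , _) }) , λ x-n∈ →
      let m′ , t′ , eq , adm′ = Equivalence.to (DiffIn⟨Gens⟩⇔Lowerable n x) x-n∈
      in 2n+4-not-lowerable n-odd 3≤n adm′ eq
    from (inj₂ (m , t , refl , adm , 4m≤t+3 , t<n)) = in-S adm , λ x-n∈ →
      let m′ , t′ , eq , (t′≤4m′ , _) = Equivalence.to (DiffIn⟨Gens⟩⇔Lowerable n x) x-n∈
      in row-top-not-lowerable m t m′ t′ n-odd t<n 4m≤t+3 t′≤4m′ eq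

row-identity : ∀ n m t r → t + r ≡ 4 * m → m * n + 2 * t + 2 * r ≡ m * (n + 8)
row-identity n m t r t+r≡4m = begin
  m * n + 2 * t + 2 * r    ≡⟨ +-assoc (m * n) (2 * t) (2 * r) ⟩
  m * n + (2 * t + 2 * r)  ≡⟨ cong (m * n +_) (sym (*-distribˡ-+ 2 t r)) ⟩
  m * n + 2 * (t + r)      ≡⟨ cong (λ s → m * n + 2 * s) t+r≡4m ⟩
  m * n + 2 * (4 * m)      ≡⟨ gather n m ⟩
  m * (n + 8)              ∎
  where
    open ≡-Reasoning
    gather : ∀ n m → m * n + 2 * (4 * m) ≡ m * (n + 8)
    gather = solve-∀

row-top⇒offset : ∀ n {m t} → t ≤ 4 * m → 4 * m ≤ t + 3 →
                 ∃ λ r → r ≤ 3 × m * n + 2 * t + 2 * r ≡ m * (n + 8)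
row-top⇒offset n {m} {t} t≤4m 4m≤t+3 with r , t+r≡4m ← m≤n⇒∃[o]m+o≡n t≤4m =
  r , +-cancelˡ-≤ t r 3 (subst (_≤ t + 3) (sym t+r≡4m) 4m≤t+3) , row-identity n m t r t+r≡4m

offset⇒row-top : ∀ {n x m r} → 2 ≤ m → r ≤ 3 → 4 * m < n → x + 2 * r ≡ m * (n + 8) → RowTop n x
offset⇒row-top {n} {x} {m} {r} 2≤m r≤3 4m<n eq =
  m , t , x≡mn+2t , (m∸n≤m (4 * m) r , not-1) , subst (_≤ t + 3) t+r≡4m (+-monoʳ-≤ t r≤3) ,
  ≤-<-trans (m∸n≤m (4 * m) r) 4m<n
  where
    t = 4 * m ∸ r
    t+r≡4m : t + r ≡ 4 * m
    t+r≡4m = m∸n+n≡m (≤-trans r≤3 (≤-trans (m≤m+n 3 5) (*-monoʳ-≤ 4 2≤m)))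
    x≡mn+2t : x ≡ m * n + 2 * t
    x≡mn+2t = +-cancelʳ-≡ (2 * r) x _ (trans eq (sym (row-identity n m t r t+r≡4m)))
    not-1 : ¬ (m ≡ 1 × t ≡ 2)
    not-1 (refl , _) = ≤⇒≯ 2≤m ≤-refl

offsets⇔ : ∀ x N → (∃ λ r → r ≤ 3 × x + 2 * r ≡ N) ⇔
                     (x + 6 ≡ N ⊎ x + 4 ≡ N ⊎ x + 2 ≡ N ⊎ x ≡ N)
offsets⇔ x N = mk⇔ to from
  where
    to : (∃ λ r → r ≤ 3 × x + 2 * r ≡ N) → x + 6 ≡ N ⊎ x + 4 ≡ N ⊎ x + 2 ≡ N ⊎ x ≡ N
    to (0 , _ , eq) = inj₂ (inj₂ (inj₂ (trans (sym (+-identityʳ x)) eq)))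
    to (1 , _ , eq) = inj₂ (inj₂ (inj₁ eq))
    to (2 , _ , eq) = inj₂ (inj₁ eq)
    to (3 , _ , eq) = inj₁ eq
    to (suc (suc (suc (suc _))) , s≤s (s≤s (s≤s ())) , _)

    from : x + 6 ≡ N ⊎ x + 4 ≡ N ⊎ x + 2 ≡ N ⊎ x ≡ N → ∃ λ r → r ≤ 3 × x + 2 * r ≡ N
    from (inj₁ eq)                 = 3 , ≤-refl , eq
    from (inj₂ (inj₁ eq))          = 2 , m≤m+n 2 1 , eq
    from (inj₂ (inj₂ (inj₁ eq)))   = 1 , m≤m+n 1 2 , eq
    from (inj₂ (inj₂ (inj₂ eq)))   = 0 , z≤n , trans (+-identityʳ x) eq

ApéryList : ℕ → ℕ → Set
ApéryList k x =
  (x ≡ 0 ⊎ x ≡ 4 * k + 7 ⊎ x ≡ 4 * k + 11 ⊎ x ≡ 4 * k + 13 ⊎ x ≡ 2 * (4 * k + 7))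
  ⊎ Σ ℕ λ j → (2 ≤ j × j ≤ k + 1)
      × (x + 6 ≡ j * (4 * k + 13) ⊎ x + 4 ≡ j * (4 * k + 13)
         ⊎ x + 2 ≡ j * (4 * k + 13) ⊎ x ≡ j * (4 * k + 13))

first-row : ∀ k i → 1 * (4 * k + 5) + 2 * i ≡ 4 * k + (5 + 2 * i)
first-row = solve-∀

double-shift : ∀ k → 2 * (4 * k + 5) + 4 ≡ 2 * (4 * k + 7)
double-shift = solve-∀

row-bound : ∀ k {m t} → 4 * m ≤ t + 3 → t < 4 * k + 5 → m ≤ k + 1
row-bound k {m} {t} 4m≤t+3 t<n = ≤-pred (*-cancelˡ-< 4 m (suc (k + 1)) (begin-strict
  4 * m            ≤⟨ 4m≤t+3 ⟩
  t + 3            <⟨ +-monoˡ-< 3 t<n ⟩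
  4 * k + 5 + 3    ≡⟨ expand k ⟩
  4 * suc (k + 1)  ∎))
  where
    open ≤-Reasoning
    expand : ∀ k → 4 * k + 5 + 3 ≡ 4 * suc (k + 1)
    expand = solve-∀

4[k+1]<4k+5 : ∀ k → 4 * (k + 1) < 4 * k + 5
4[k+1]<4k+5 k = ≤-reflexive (expand k)
  where
    expand : ∀ k → suc (4 * (k + 1)) ≡ 4 * k + 5
    expand = solve-∀

small<4k+5 : ∀ k {t} → t ≤ 4 → t < 4 * k + 5
small<4k+5 k t≤4 = ≤-trans (s≤s t≤4) (m≤n+m 5 (4 * k))

first-row-entry : ∀ k {t} → 1 ≤ t → t ≤ 4 → t ≢ 2 → RowTop (4 * k + 5) (4 * k + (5 + 2 * t))
first-row-entry k {t} 1≤t t≤4 t≢2 =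
  1 , t , sym (first-row k t) , (t≤4 , t≢2 ∘ proj₂) , +-monoˡ-≤ 3 1≤t , small<4k+5 k t≤4

RowTop⇒ApéryList : ∀ k x → x ≡ 2 * (4 * k + 5) + 4 ⊎ RowTop (4 * k + 5) x → ApéryList k x
RowTop⇒ApéryList k x (inj₁ refl) = inj₁ (inj₂ (inj₂ (inj₂ (inj₂ (double-shift k)))))
RowTop⇒ApéryList k x (inj₂ (0 , _ , eq , (z≤n , _) , _)) = inj₁ (inj₁ eq)
RowTop⇒ApéryList k x (inj₂ (1 , 0 , _ , _ , s≤s (s≤s (s≤s ())) , _))
RowTop⇒ApéryList k x (inj₂ (1 , 1 , eq , _)) = inj₁ (inj₂ (inj₁ (trans eq (first-row k 1))))
RowTop⇒ApéryList k x (inj₂ (1 , 2 , _ , (_ , not-1,2) , _)) = contradiction (refl , refl) not-1,2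
RowTop⇒ApéryList k x (inj₂ (1 , 3 , eq , _)) =
  inj₁ (inj₂ (inj₂ (inj₁ (trans eq (first-row k 3)))))
RowTop⇒ApéryList k x (inj₂ (1 , 4 , eq , _)) =
  inj₁ (inj₂ (inj₂ (inj₂ (inj₁ (trans eq (first-row k 4))))))
RowTop⇒ApéryList k x (inj₂ (1 , suc (suc (suc (suc (suc _)))) , _ , (s≤s (s≤s (s≤s (s≤s ()))) , _) , _))
RowTop⇒ApéryList k x (inj₂ (m@(suc (suc _)) , t , refl , (t≤4m , _) , 4m≤t+3 , t<n))
  with r , r≤3 , eq ← row-top⇒offset (4 * k + 5) t≤4m 4m≤t+3 =
  inj₂ (m , (s≤s (s≤s z≤n) , row-bound k 4m≤t+3 t<n) ,
        Equivalence.to (offsets⇔ x (m * (4 * k + 13)))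
          (r , r≤3 , trans eq (cong (m *_) (+-assoc (4 * k) 5 8))))

ApéryList⇒RowTop : ∀ k x → ApéryList k x → x ≡ 2 * (4 * k + 5) + 4 ⊎ RowTop (4 * k + 5) x
ApéryList⇒RowTop k x (inj₁ (inj₁ refl)) =
  inj₂ (0 , 0 , refl , (z≤n , λ { (() , _) }) , z≤n , small<4k+5 k z≤n)
ApéryList⇒RowTop k x (inj₁ (inj₂ (inj₁ refl))) =
  inj₂ (first-row-entry k {1} ≤-refl (m≤m+n 1 3) λ ())
ApéryList⇒RowTop k x (inj₁ (inj₂ (inj₂ (inj₁ refl)))) =
  inj₂ (first-row-entry k {3} (m≤m+n 1 2) (m≤m+n 3 1) λ ())
ApéryList⇒RowTop k x (inj₁ (inj₂ (inj₂ (inj₂ (inj₁ refl))))) =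
  inj₂ (first-row-entry k {4} (m≤m+n 1 3) ≤-refl λ ())
ApéryList⇒RowTop k x (inj₁ (inj₂ (inj₂ (inj₂ (inj₂ refl))))) = inj₁ (sym (double-shift k))
ApéryList⇒RowTop k x (inj₂ (j , (2≤j , j≤k+1) , tops))
  with r , r≤3 , eq ← Equivalence.from (offsets⇔ x (j * (4 * k + 13))) tops =
  inj₂ (offset⇒row-top 2≤j r≤3 (≤-<-trans (*-monoʳ-≤ 4 j≤k+1) (4[k+1]<4k+5 k))
                       (trans eq (cong (j *_) (sym (+-assoc (4 * k) 5 8)))))

Gens-4k+5 : ∀ k → Gens (4 * k + 5) ≡ (4 * k + 5) ∷ (4 * k + 7) ∷ (4 * k + 11) ∷ (4 * k + 13) ∷ []
Gens-4k+5 k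
  rewrite +-identityʳ (4 * k + 5) | +-assoc (4 * k) 5 2 | +-assoc (4 * k) 5 6 | +-assoc (4 * k) 5 8
  = refl

4k+5-odd : ∀ k → (4 * k + 5) % 2 ≡ 1
4k+5-odd k = trans (%-congˡ (as-odd k)) ([m+kn]%n≡m%n 1 (2 * k + 2) 2)
  where
    as-odd : ∀ k → 4 * k + 5 ≡ 1 + (2 * k + 2) * 2
    as-odd = solve-∀

corollary25 : (k : ℕ) → 1 ≤ k → (x : ℕ) →
    Ap ⟨ (4 * k + 5) ∷ (4 * k + 7) ∷ (4 * k + 11) ∷ (4 * k + 13) ∷ [] ⟩ (4 * k + 5) x
    ⇔ ((x ≡ 0 ⊎ x ≡ 4 * k + 7 ⊎ x ≡ 4 * k + 11 ⊎ x ≡ 4 * k + 13 ⊎ x ≡ 2 * (4 * k + 7))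
       ⊎ Σ ℕ λ j → (2 ≤ j × j ≤ k + 1)
           × (x + 6 ≡ j * (4 * k + 13) ⊎ x + 4 ≡ j * (4 * k + 13)
              ⊎ x + 2 ≡ j * (4 * k + 13) ⊎ x ≡ j * (4 * k + 13)))
corollary25 k _ x =
  subst (λ X → Ap ⟨ X ⟩ (4 * k + 5) x ⇔ ApéryList k x) (Gens-4k+5 k)
    (⇔-trans (Ap⟨Gens⟩⇔ (4k+5-odd k) (small<4k+5 k (m≤m+n 2 2)) x)
              (mk⇔ (RowTop⇒ApéryList k x) (ApéryList⇒RowTop k x)))
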